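{- Let $NC$ be a neuronal circuit satisfying $\mathit{Series}(NC)$, which is initial. Write $n=|ln_{NC}|$ and $N_j$ for the neuron of $ln_{NC}$ with identifier $j$ ($0\le j<n$). Assume $w_{N_0}(n)\ge \tau_{N_0}$ (the weight of the external source on $N_0$ reaches $N_0$'s threshold) and, for every $i\in\mathbb{N}$ with $i+1<n$, $w_{N_{i+1}}(i)\ge \tau_{N_{i+1}}$. Then for every neuron $N\in ln_{NC}$ and every external input sequence $\mathit{inp}$ (a list of booleans), $$output_{NC}(N,\mathit{inp})=\begin{cases}\mathit{inp}[id_N:\,]\mathbin{++}\mathit{repeat}(0,id_N+1) & \text{if } id_N\le |\mathit{inp}|,\\ \mathit{repeat}(0,|\mathit{inp}|+1) & \text{otherwise.}\end{cases}$$
   Context: Booleans are identified with $0$ (false) and $1$ (true). A neuron $N$ consists of an identifier $id_N\in\mathbb{N}$, a weight function $w_N:\mathbb{N}\to\mathbb{Q}$ with $-1\le w_N(x)\le 1$ for all $x$ and $w_N(id_N)=0$, a leak factor $lk_N\in\mathbb{Q}$ with $0\le lk_N\le 1$, a threshold $\tau_N\in\mathbb{Q}$ with $\tau_N>0$, an output list $Output(N)$ of booleans (most recent first) and a current potential $CurPot(N)\in\mathbb{Q}$, subject to: $(\tau_N\le CurPot(N))$ equals the head of $Output(N)$ (the head of an empty list being $0$). An input function is a map $i:\mathbb{N}\to\{0,1\}$; $potential(w,i,len)=\sum_{0\le k<len,\ i(k)=1} w(k)$. The one-step update of $N$ with input function $i$ in an environment of $len$ neurons keeps $id,w,lk,\tau$,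 sets the new potential $p=potential(w_N,i,len)$ if $\tau_N\le CurPot(N)$ and $p=potential(w_N,i,len)+lk_N\cdot CurPot(N)$ otherwise, and sets the new output list to $(\tau_N\le p)::Output(N)$. A neuron is initial if its output list is $[0]$ and its current potential is $0$. A neuronal circuit $NC$ consists of a time $t_{NC}\in\mathbb{N}$, a list $ln_{NC}$ of neurons with pairwise distinct identifiers all $<|ln_{NC}|$ (so identifiers are exactly $0,\dots,|ln_{NC}|-1$) and all output lists of length $t_{NC}+1$, and a number $si_{NC}$ of external sources, which have identifiers $|ln_{NC}|,\dots,L-1$ where $L=|ln_{NC}|+si_{NC}$. One step of $NC$ on an external input function $e$ replaces each neuron $N$ by its one-step update in an environment of $L$ neurons with input function $x\mapsto$ (head of the output list, before the step, of the circuit neuron with identifier $x$ if $x<|ln_{NC}|$; $e(x)$ otherwise), and increments the time. A list of external inputs (most recent first) is processed from its last element to its first. For $N\in ln_{NC}$, $output_{NC}(N,\mathit{inp})$ is the output list of the neuron with identifier $id_N$ after processing $\mathit{inp}$. $NC$ is initial if all its neurons are initial. When $si_{NC}=1$, an external input sequence is a list of booleans, each giving the value supplied by the unique external source (identifier $|ln_{NC}|$) at that step. $\mathit{Series}(NC)$ means: $si_{NC}=1$; $|ln_{NC}|\ge 1$; the neuron with identifier $0$ has $w(id')=0$ for all $id'<|ln_{NC}|$ and $w(|ln_{NC}|)>0$; for every $m$, the neuron with identifier $m+1$ (if present) has $w(id')=0$ for all $id'\ne m$ with $id'<|ln_{NC}|+1$, and $w(m)>0$. List notation: $\mathbin{++}$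 is concatenation; $\mathit{repeat}(v,k)$ is the list of $k$ copies of $v$; $l[i:\,]$ is $l$ with its first $i$ elements removed (empty if $i\ge|l|$). -}

module Defs where

open import Data.Bool using (Bool; true; false; if_then_else_)
open import Data.Nat as ℕ using (ℕ; zero; suc; _<ᵇ_)
open import Data.Rational using (ℚ; 0ℚ; 1ℚ; -_; _+_; _*_; _≤_; _<_; _≤ᵇ_)
open import Data.List using (List; []; _∷_; length; map)
open import Data.List.Membership.Propositional using (_∈_)
open import Data.List.Relation.Unary.All using (All)
open import Data.List.Relation.Unary.Unique.Propositional using (Unique)
open import Data.Maybe using (Maybe; just; nothing)
open import Relation.Binary.PropositionalEquality using (_≡_; _≢_; refl)

headB : List Bool → Bool
headB []      = false
headB (b ∷ _) = b

record Neuron : Set where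
  field
    id      : ℕ
    w       : ℕ → ℚ
    lk      : ℚ
    τ       : ℚ
    output  : List Bool          -- most recent first
    curPot  : ℚ
    w-lo    : ∀ x → - 1ℚ ≤ w x
    w-hi    : ∀ x → w x ≤ 1ℚ
    w-self  : w id ≡ 0ℚ
    lk-lo   : 0ℚ ≤ lk
    lk-hi   : lk ≤ 1ℚ
    τ-pos   : 0ℚ < τ
    consistent : (τ ≤ᵇ curPot) ≡ headB output

open Neuron public

potential : (ℕ → ℚ) → (ℕ → Bool) → ℕ → ℚ
potential w i zero    = 0ℚ
potential w i (suc k) = potential w i k + (if i k then w k else 0ℚ)

update : ℕ → (ℕ → Bool) → Neuron → Neuron
update len i N = record
  { id = id N ; w = w N ; lk = lk N ; τ = τ N
  ; output = (τ N ≤ᵇ p) ∷ output N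
  ; curPot = p
  ; w-lo = w-lo N ; w-hi = w-hi N ; w-self = w-self N
  ; lk-lo = lk-lo N ; lk-hi = lk-hi N ; τ-pos = τ-pos N
  ; consistent = refl }
  where
  p : ℚ
  p = if τ N ≤ᵇ curPot N
        then potential (w N) i len
        else potential (w N) i len + lk N * curPot N

findById : ℕ → List Neuron → Maybe Neuron
findById x []       = nothing
findById x (N ∷ ns) = if x ℕ.≡ᵇ id N then just N else findById x ns

initialNeuron : Neuron → Set
initialNeuron N = (output N ≡ false ∷ []) Data.Product.× (curPot N ≡ 0ℚ)
  where import Data.Product

record Circuit : Set where
  field
    time  : ℕ
    ln    : List Neuron
    si    : ℕ
    ids-distinct : Unique (map id ln)
    ids-bound    : All (λ N → id N ℕ.< length ln) ln
    out-length   : All (λ N → length (output N) ≡ suc time) ln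

open Circuit public

stepInput : List Neuron → (ℕ → Bool) → ℕ → Bool
stepInput ns e x with x <ᵇ length ns
... | true  = headB' (findById x ns)
  where
  headB' : Maybe Neuron → Bool
  headB' (just N) = headB (output N)
  headB' nothing  = false
... | false = e x

stepNeurons : ℕ → List Neuron → (ℕ → Bool) → List Neuron
stepNeurons s ns e = map (update (length ns ℕ.+ s) (stepInput ns e)) ns

-- process a list of external input functions, most recent first (last element first)
processFns : ℕ → List Neuron → List (ℕ → Bool) → List Neuron
processFns s ns []       = ns
processFns s ns (e ∷ es) = stepNeurons s (processFns s ns es) e

-- with a single external source, the boolean b is the value supplied by that source
-- (only the identifier |ln| is read as external, so the constant function suffices)
boolInput : Bool → ℕ → Bool
boolInput b _ = b

-- output_NC(N, inp) for an external input sequence of booleans (si = 1 case)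
outputNC : Circuit → Neuron → List Bool → Maybe (List Bool)
outputNC NC N inp =
  Data.Maybe.map output (findById (id N) (processFns (si NC) (ln NC) (map boolInput inp)))
  where import Data.Maybe

Initial : Circuit → Set
Initial NC = All initialNeuron (ln NC)

Series : Circuit → Set
Series NC =
  (si NC ≡ 1) ×
  (1 ℕ.≤ n) ×
  (∀ N → N ∈ ln NC → id N ≡ 0 →
      (∀ id' → id' ℕ.< n → w N id' ≡ 0ℚ) × (0ℚ < w N n)) ×
  (∀ N m → N ∈ ln NC → id N ≡ suc m →
      (∀ id' → id' ≢ m → id' ℕ.< n ℕ.+ 1 → w N id' ≡ 0ℚ) × (0ℚ < w N m))
  where
  open import Data.Product using (_×_)
  n = length (ln NC)

-- Each neuron has a single nonzero incoming weight, from its source (the external input for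
-- neuron 0, neuron m for neuron m + 1), and that weight reaches its threshold. A neuron that
-- has just fired or holds potential 0 carries nothing over, whatever its leak factor, so it
-- fires exactly when its source is active, and afterwards it has again fired or received 0.
-- By induction on the input, neuron j thus shows the input delayed by j steps. That every
-- source exists is a pigeonhole argument: the identifiers are distinct and below n.

module Submission where

open import Defs
open import Data.Bool using (Bool; false)
open import Data.Nat using (ℕ; suc; _+_)
open import Data.Rational using (_≤_)
open import Data.List using (List; length; drop; replicate; _++_)
open import Data.List.Membership.Propositional using (_∈_)
open import Data.Maybe using (just)
open import Data.Product using (_×_)
open import Relation.Nullary using (¬_)
open import Relation.Binary.PropositionalEquality using (_≡_)

open import Data.Bool using (true; if_then_else_; T)
open import Data.Empty using (⊥-elim)
open import Data.Fin as Fin using (Fin; fromℕ<; punchOut)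
import Data.Fin.Properties as Finₚ
open import Data.List using ([]; _∷_; [_]; _∷ʳ_; map; lookup)
open import Data.List.Properties using (++-assoc; drop-[]; drop-all; length-map; map-id; map-∘)
open import Data.List.Membership.Propositional.Properties using (∈-lookup; ∈-map⁻)
open import Data.List.Relation.Unary.All as All using (All)
import Data.List.Relation.Unary.All.Properties as All
open import Data.List.Relation.Unary.Any using (here; there)
open import Data.List.Relation.Unary.AllPairs using (_∷_)
open import Data.List.Relation.Unary.Unique.Propositional using (Unique)
import Data.Maybe as Maybe
open import Data.Nat as ℕ using (zero; _≡ᵇ_; _<ᵇ_)
import Data.Nat.Properties as ℕₚ
open import Data.List.Membership.DecPropositional ℕ._≟_ using (_∈?_)
open import Data.Product using (Σ-syntax; _,_; proj₁; proj₂; map₂)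
open import Data.Rational as ℚ using (ℚ; 0ℚ; _≤ᵇ_)
import Data.Rational.Properties as ℚₚ
open import Data.Sum using (_⊎_; inj₁; inj₂)
open import Data.Unit using (tt)
open import Function using (_∘_; Injective)
open import Relation.Binary.PropositionalEquality using (refl; sym; trans; cong; cong₂; subst; subst₂; _≢_; module ≡-Reasoning)
open import Relation.Nullary using (yes; no; contradiction)
open import Relation.Nullary.Decidable using (dec-true; dec-false; T?)

open ≡-Reasoning

replicate-∷ʳ : ∀ {A : Set} n (x : A) → replicate n x ∷ʳ x ≡ x ∷ replicate n x
replicate-∷ʳ zero    x = refl
replicate-∷ʳ (suc n) x = cong (x ∷_) (replicate-∷ʳ n x)

-- The output trace of a j-step delay line fed with bs (most recent first): headB (drop j bs)
-- is the input of j steps ago, or 0 if there was none.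
delayed : ℕ → List Bool → List Bool
delayed j []       = false ∷ []
delayed j (b ∷ bs) = headB (drop j (b ∷ bs)) ∷ delayed j bs

headB-delayed : ∀ j bs → headB (delayed j bs) ≡ headB (drop j bs)
headB-delayed j []      = cong headB (sym (drop-[] j))
headB-delayed j (_ ∷ _) = refl

delayed-zero : ∀ bs → delayed 0 bs ≡ bs ∷ʳ false
delayed-zero []       = refl
delayed-zero (b ∷ bs) = cong (b ∷_) (delayed-zero bs)

delayed-suc : ∀ j b bs → delayed (suc j) (b ∷ bs) ≡ delayed j bs ∷ʳ false
delayed-suc j b []       = cong (_∷ [ false ]) (cong headB (drop-[] j))
delayed-suc j b (c ∷ cs) = cong (headB (drop j (c ∷ cs)) ∷_) (delayed-suc j c cs)

delayed-≤ : ∀ {j bs} → j ℕ.≤ length bs → delayed j bs ≡ drop j bs ++ replicate (j + 1) false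
delayed-≤ {zero}  {bs}     _          = delayed-zero bs
delayed-≤ {suc j} {b ∷ bs} (ℕ.s≤s j≤) = begin
  delayed (suc j) (b ∷ bs)                              ≡⟨ delayed-suc j b bs ⟩
  delayed j bs ∷ʳ false                                 ≡⟨ cong (_∷ʳ false) (delayed-≤ j≤) ⟩
  (drop j bs ++ replicate (j + 1) false) ∷ʳ false       ≡⟨ ++-assoc (drop j bs) _ _ ⟩
  drop j bs ++ (replicate (j + 1) false ∷ʳ false)       ≡⟨ cong (drop j bs ++_) (replicate-∷ʳ (j + 1) false) ⟩
  drop j bs ++ replicate (suc j + 1) false              ∎

delayed-> : ∀ {j bs} → length bs ℕ.< j → delayed j bs ≡ replicate (length bs + 1) false
delayed-> {j} {[]}     _ = refl
delayed-> {j} {b ∷ bs} bs<j =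
  cong₂ _∷_ (cong headB (drop-all j (b ∷ bs) (ℕₚ.<⇒≤ bs<j))) (delayed-> (ℕₚ.<-trans (ℕₚ.n<1+n _) bs<j))

gated-zero : ∀ b {x} → x ≡ 0ℚ → (if b then x else 0ℚ) ≡ 0ℚ
gated-zero true  x≡0 = x≡0
gated-zero false _   = refl

potential-zero : ∀ {w i len} → (∀ k → k ℕ.< len → w k ≡ 0ℚ) → potential w i len ≡ 0ℚ
potential-zero {len = zero}            _  = refl
potential-zero {w} {i} {len = suc len} w≡0 = begin
  potential w i len ℚ.+ (if i len then w len else 0ℚ)
    ≡⟨ cong₂ ℚ._+_ (potential-zero (λ k k< → w≡0 k (ℕₚ.m<n⇒m<1+n k<))) (gated-zero (i len) (w≡0 len (ℕₚ.n<1+n len))) ⟩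
  0ℚ ℚ.+ 0ℚ
    ≡⟨ ℚₚ.+-identityʳ 0ℚ ⟩
  0ℚ ∎

potential-single : ∀ {w i m len} → m ℕ.< len → (∀ k → k ℕ.< len → k ≢ m → w k ≡ 0ℚ) →
  potential w i len ≡ (if i m then w m else 0ℚ)
potential-single {w} {i} {m} {suc len} m<1+len w≡0 with m ℕ.≟ len
... | yes refl = begin
  potential w i m ℚ.+ (if i m then w m else 0ℚ)
    ≡⟨ cong (ℚ._+ (if i m then w m else 0ℚ)) (potential-zero (λ k k<m → w≡0 k (ℕₚ.m<n⇒m<1+n k<m) (ℕₚ.<⇒≢ k<m))) ⟩
  0ℚ ℚ.+ (if i m then w m else 0ℚ)
    ≡⟨ ℚₚ.+-identityˡ _ ⟩
  (if i m then w m else 0ℚ) ∎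
... | no m≢len = begin
  potential w i len ℚ.+ (if i len then w len else 0ℚ)
    ≡⟨ cong₂ ℚ._+_ (potential-single (ℕₚ.≤∧≢⇒< (ℕₚ.m<1+n⇒m≤n m<1+len) m≢len) (λ k k< → w≡0 k (ℕₚ.m<n⇒m<1+n k<)))
                   (gated-zero (i len) (w≡0 len (ℕₚ.n<1+n len) (m≢len ∘ sym))) ⟩
  (if i m then w m else 0ℚ) ℚ.+ 0ℚ
    ≡⟨ ℚₚ.+-identityʳ _ ⟩
  (if i m then w m else 0ℚ) ∎

≤ᵇ-true : ∀ {p q} → p ≤ q → (p ≤ᵇ q) ≡ true
≤ᵇ-true = dec-true (T? _) ∘ ℚₚ.≤⇒≤ᵇ

<⇒≤ᵇ-false : ∀ {p q} → q ℚ.< p → (p ≤ᵇ q) ≡ false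
<⇒≤ᵇ-false q<p = dec-false (T? _) (λ p≤q → ℚₚ.<-irrefl refl (ℚₚ.<-≤-trans q<p (ℚₚ.≤ᵇ⇒≤ p≤q)))

≤ᵇ-gated : ∀ {τ x} → 0ℚ ℚ.< τ → τ ≤ x → ∀ b → (τ ≤ᵇ (if b then x else 0ℚ)) ≡ b
≤ᵇ-gated _   τ≤x true  = ≤ᵇ-true τ≤x
≤ᵇ-gated 0<τ _   false = <⇒≤ᵇ-false 0<τ

Discharged : Neuron → Set
Discharged N = τ N ≤ curPot N ⊎ curPot N ≡ 0ℚ

gated-discharged : ∀ {τ x} → τ ≤ x → ∀ b → τ ≤ (if b then x else 0ℚ) ⊎ (if b then x else 0ℚ) ≡ 0ℚ
gated-discharged τ≤x true  = inj₁ τ≤x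
gated-discharged _   false = inj₂ refl

update-curPot : ∀ {N len i} → Discharged N → curPot (update len i N) ≡ potential (w N) i len
update-curPot {N} {len} {i} (inj₁ fired) = cong (λ b → if b then p else p ℚ.+ lk N ℚ.* curPot N) (≤ᵇ-true fired)
  where
  p : ℚ
  p = potential (w N) i len
update-curPot {N} {len} {i} (inj₂ empty) = begin
  (if τ N ≤ᵇ curPot N then p else p ℚ.+ lk N ℚ.* curPot N) ≡⟨ cong (λ c → if τ N ≤ᵇ c then p else p ℚ.+ lk N ℚ.* c) empty ⟩
  (if τ N ≤ᵇ 0ℚ then p else p ℚ.+ lk N ℚ.* 0ℚ)           ≡⟨ cong (λ b → if b then p else p ℚ.+ lk N ℚ.* 0ℚ) (<⇒≤ᵇ-false (τ-pos N)) ⟩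
  p ℚ.+ lk N ℚ.* 0ℚ                                       ≡⟨ cong (p ℚ.+_) (ℚₚ.*-zeroʳ (lk N)) ⟩
  p ℚ.+ 0ℚ                                                ≡⟨ ℚₚ.+-identityʳ p ⟩
  p                                                       ∎
  where
  p : ℚ
  p = potential (w N) i len

update-relays : ∀ {N len i k} → Discharged N → potential (w N) i len ≡ (if i k then w N k else 0ℚ) → τ N ≤ w N k →
  output (update len i N) ≡ i k ∷ output N × Discharged (update len i N)
update-relays {N} {len} {i} {k} discharged single τ≤w =
    cong (_∷ output N) (trans (cong (τ N ≤ᵇ_) curPot≡) (≤ᵇ-gated (τ-pos N) τ≤w (i k)))
  , subst (λ p → τ N ≤ p ⊎ p ≡ 0ℚ) (sym curPot≡) (gated-discharged τ≤w (i k))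
  where
  curPot≡ : curPot (update len i N) ≡ (if i k then w N k else 0ℚ)
  curPot≡ = trans (update-curPot {N} {len} {i} discharged) single

findById-map : ∀ {x} {f : Neuron → Neuron} ns → (∀ N → id (f N) ≡ id N) →
  findById x (map f ns) ≡ Maybe.map f (findById x ns)
findById-map []                _    = refl
findById-map {x} {f} (N ∷ ns) id-f rewrite id-f N with x ≡ᵇ id N
... | true  = refl
... | false = findById-map ns id-f

findById-∈ : ∀ {x N ns} → N ∈ ns → id N ≡ x → Σ[ M ∈ Neuron ] M ∈ ns × id M ≡ x × findById x ns ≡ just M
findById-∈ {x} {N} {M ∷ ns} N∈ idN with x ≡ᵇ id M in x≡ᵇM
... | true = M , here refl , sym (ℕₚ.≡ᵇ⇒≡ x (id M) (subst T (sym x≡ᵇM) tt)) , refl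
... | false with N∈
...   | here refl = ⊥-elim (subst T x≡ᵇM (ℕₚ.≡⇒≡ᵇ x (id N) (sym idN)))
...   | there N∈ns with findById-∈ N∈ns idN
...     | M′ , M′∈ , idM′ , found = M′ , there M′∈ , idM′ , found

stepInput-internal : ∀ {ns e x M} → x ℕ.< length ns → findById x ns ≡ just M → stepInput ns e x ≡ headB (output M)
stepInput-internal {ns} {e} {x} x< found with x <ᵇ length ns in internal
... | true rewrite found = refl
... | false = ⊥-elim (subst T internal (ℕₚ.<⇒<ᵇ x<))

stepInput-external : ∀ {ns e x} → length ns ℕ.≤ x → stepInput ns e x ≡ e x
stepInput-external {ns} {e} {x} ≤x with x <ᵇ length ns in internal
... | true  = ⊥-elim (ℕₚ.≤⇒≯ ≤x (ℕₚ.<ᵇ⇒< x (length ns) (subst T (sym internal) tt)))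
... | false = refl

lookup-injective : ∀ {A : Set} {xs : List A} → Unique xs → Injective _≡_ _≡_ (lookup xs)
lookup-injective (_    ∷ _) {Fin.zero}  {Fin.zero}  _  = refl
lookup-injective (x∉xs ∷ _) {Fin.zero}  {Fin.suc j} eq = contradiction eq (All.lookup x∉xs (∈-lookup j))
lookup-injective (x∉xs ∷ _) {Fin.suc i} {Fin.zero}  eq = contradiction (sym eq) (All.lookup x∉xs (∈-lookup i))
lookup-injective (_ ∷ uniq) {Fin.suc i} {Fin.suc j} eq = cong Fin.suc (lookup-injective uniq eq)

-- If m were missing, punching it out would inject Fin (length xs) into Fin (n ∸ 1).
∈-unique-bounded : ∀ {n m xs} → Unique xs → All (ℕ._< n) xs → n ℕ.≤ length xs → m ℕ.< n → m ∈ xs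
∈-unique-bounded {suc n} {m} {xs} uniq bounded n≤ m< with m ∈? xs
... | yes m∈ = m∈
... | no  m∉ = contradiction (Finₚ.injective⇒≤ squeeze-injective) (ℕₚ.<⇒≱ n≤)
  where
  index : Fin (length xs) → Fin (suc n)
  index i = fromℕ< (All.lookup bounded (∈-lookup i))

  index-injective : Injective _≡_ _≡_ index
  index-injective eq = lookup-injective uniq (Finₚ.fromℕ<-injective _ _ _ _ eq)

  missed : ∀ i → fromℕ< m< ≢ index i
  missed i eq = m∉ (subst (_∈ xs) (sym (Finₚ.fromℕ<-injective _ _ _ _ eq)) (∈-lookup i))

  squeeze : Fin (length xs) → Fin n
  squeeze i = punchOut (missed i)

  squeeze-injective : Injective _≡_ _≡_ squeeze
  squeeze-injective eq = index-injective (Finₚ.punchOut-injective (missed _) (missed _) eq)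

evolve : ℕ → List Neuron → List (ℕ → Bool) → Neuron → Neuron
evolve s ns []       N = N
evolve s ns (e ∷ es) N = update (length ns + s) (stepInput (map (evolve s ns es) ns) e) (evolve s ns es N)

processFns-evolve : ∀ s ns es → processFns s ns es ≡ map (evolve s ns es) ns
processFns-evolve s ns []       = sym (map-id ns)
processFns-evolve s ns (e ∷ es) rewrite processFns-evolve s ns es | length-map (evolve s ns es) ns = sym (map-∘ ns)

id-evolve : ∀ s ns es N → id (evolve s ns es N) ≡ id N
id-evolve s ns []       N = refl
id-evolve s ns (_ ∷ es) N = id-evolve s ns es N

w-evolve : ∀ s ns es N → w (evolve s ns es N) ≡ w N
w-evolve s ns []       N = refl
w-evolve s ns (_ ∷ es) N = w-evolve s ns es N

τ-evolve : ∀ s ns es N → τ (evolve s ns es N) ≡ τ N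
τ-evolve s ns []       N = refl
τ-evolve s ns (_ ∷ es) N = τ-evolve s ns es N

module Relay (NC : Circuit) (series : Series NC) (initial : Initial NC)
  (τ≤w-source : ∀ N → N ∈ ln NC → id N ≡ 0 → τ N ≤ w N (length (ln NC)))
  (τ≤w-pred : ∀ N i → N ∈ ln NC → id N ≡ suc i → suc i ℕ.< length (ln NC) → τ N ≤ w N i)
  where

  n : ℕ
  n = length (ln NC)

  after : List Bool → Neuron → Neuron
  after bs = evolve 1 (ln NC) (map boolInput bs)

  input : Bool → List Bool → ℕ → Bool
  input b bs = stepInput (map (after bs) (ln NC)) (boolInput b)

  source : ℕ → ℕ
  source zero    = n
  source (suc m) = m

  id< : ∀ {N} → N ∈ ln NC → id N ℕ.< n
  id< = All.lookup (ids-bound NC)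

  source< : ∀ {N} → N ∈ ln NC → source (id N) ℕ.< n + 1
  source< {N} N∈ with id N in idN
  ... | zero  = ℕₚ.m<m+n n ℕₚ.0<1+n
  ... | suc m = ℕₚ.m≤n⇒m≤n+o 1 (ℕₚ.<⇒≤ (subst (ℕ._< n) idN (id< N∈)))

  weights-single : ∀ {N} → N ∈ ln NC → ∀ k → k ℕ.< n + 1 → k ≢ source (id N) → w N k ≡ 0ℚ
  weights-single {N} N∈ k k< k≢ with id N in idN
  ... | zero  = proj₁ (proj₁ (proj₂ (proj₂ series)) N N∈ idN) k
                  (ℕₚ.≤∧≢⇒< (ℕₚ.m<1+n⇒m≤n (subst (k ℕ.<_) (ℕₚ.+-comm n 1) k<)) k≢)
  ... | suc m = proj₁ (proj₂ (proj₂ (proj₂ series)) N m N∈ idN) k k≢ k<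

  potential-source : ∀ bs {N} i → N ∈ ln NC →
    potential (w (after bs N)) i (n + 1) ≡ (if i (source (id N)) then w (after bs N) (source (id N)) else 0ℚ)
  potential-source bs {N} i N∈ rewrite w-evolve 1 (ln NC) (map boolInput bs) N =
    potential-single (source< N∈) (weights-single N∈)

  τ≤w-after : ∀ bs {N} → N ∈ ln NC → τ (after bs N) ≤ w (after bs N) (source (id N))
  τ≤w-after bs {N} N∈ rewrite w-evolve 1 (ln NC) (map boolInput bs) N | τ-evolve 1 (ln NC) (map boolInput bs) N
    with id N in idN
  ... | zero  = τ≤w-source N N∈ idN
  ... | suc m = τ≤w-pred N m N∈ idN (subst (ℕ._< n) idN (id< N∈))

  neuron-with-id : ∀ {m} → m ℕ.< n → Σ[ N ∈ Neuron ] N ∈ ln NC × id N ≡ m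
  neuron-with-id m< with ∈-map⁻ id (∈-unique-bounded (ids-distinct NC) (All.map⁺ (ids-bound NC))
                                      (ℕₚ.≤-reflexive (sym (length-map id (ln NC)))) m<)
  ... | N , N∈ , m≡ = N , N∈ , sym m≡

  findById-after : ∀ bs {N x} → N ∈ ln NC → id N ≡ x →
    Σ[ M ∈ Neuron ] M ∈ ln NC × id M ≡ x × findById x (map (after bs) (ln NC)) ≡ just (after bs M)
  findById-after bs N∈ idN with findById-∈ N∈ idN
  ... | M , M∈ , idM , found =
    M , M∈ , idM , trans (findById-map (ln NC) (id-evolve 1 (ln NC) (map boolInput bs))) (cong (Maybe.map (after bs)) found)

  input-source : ∀ b bs → (∀ {M} → M ∈ ln NC → headB (output (after bs M)) ≡ headB (drop (id M) bs)) →
    ∀ {N} → N ∈ ln NC → input b bs (source (id N)) ≡ headB (drop (id N) (b ∷ bs))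
  input-source b bs heads {N} N∈ with id N in idN
  ... | zero  = stepInput-external {map (after bs) (ln NC)} (ℕₚ.≤-reflexive (length-map (after bs) (ln NC)))
  ... | suc m with neuron-with-id (ℕₚ.<⇒≤ (subst (ℕ._< n) idN (id< N∈)))
  ...   | N′ , N′∈ , idN′ with findById-after bs N′∈ idN′
  ...     | M , M∈ , idM , found = begin
    input b bs m                 ≡⟨ stepInput-internal {map (after bs) (ln NC)} m<length found ⟩
    headB (output (after bs M))  ≡⟨ heads M∈ ⟩
    headB (drop (id M) bs)       ≡⟨ cong (λ j → headB (drop j bs)) idM ⟩
    headB (drop m bs)            ∎
    where
    m<length : m ℕ.< length (map (after bs) (ln NC))
    m<length = subst₂ ℕ._<_ idM (sym (length-map (after bs) (ln NC))) (id< M∈)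

  relays : ∀ bs {N} → N ∈ ln NC → output (after bs N) ≡ delayed (id N) bs × Discharged (after bs N)
  relays []           N∈ = map₂ inj₂ (All.lookup initial N∈)
  relays (b ∷ bs) {N} N∈
    with update-relays {after bs N} {n + 1} {input b bs} {source (id N)}
           (proj₂ (relays bs N∈)) (potential-source bs (input b bs) N∈) (τ≤w-after bs N∈)
  ... | fired , discharged =
    trans fired (cong₂ _∷_ (input-source b bs heads N∈) (proj₁ (relays bs N∈))) , discharged
    where
    heads : ∀ {M} → M ∈ ln NC → headB (output (after bs M)) ≡ headB (drop (id M) bs)
    heads {M} M∈ = trans (cong headB (proj₁ (relays bs M∈))) (headB-delayed (id M) bs)

  outputNC-delayed : ∀ {N} → N ∈ ln NC → ∀ inp → outputNC NC N inp ≡ just (delayed (id N) inp)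
  outputNC-delayed {N} N∈ inp with findById-after inp N∈ refl
  ... | M , M∈ , idM , found = begin
    outputNC NC N inp
      ≡⟨ cong (λ s → Maybe.map output (findById (id N) (processFns s (ln NC) (map boolInput inp)))) (proj₁ series) ⟩
    Maybe.map output (findById (id N) (processFns 1 (ln NC) (map boolInput inp)))
      ≡⟨ cong (Maybe.map output ∘ findById (id N)) (processFns-evolve 1 (ln NC) (map boolInput inp)) ⟩
    Maybe.map output (findById (id N) (map (after inp) (ln NC)))
      ≡⟨ cong (Maybe.map output) found ⟩
    just (output (after inp M))
      ≡⟨ cong just (proj₁ (relays inp M∈)) ⟩
    just (delayed (id M) inp)
      ≡⟨ cong (λ j → just (delayed j inp)) idM ⟩
    just (delayed (id N) inp) ∎

proposition6p1 : (NC : Circuit) → Series NC → Initial NC →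
    (∀ N → N ∈ ln NC → id N ≡ 0 → τ N ≤ w N (length (ln NC))) →
    (∀ N i → N ∈ ln NC → id N ≡ suc i → suc i Data.Nat.< length (ln NC) → τ N ≤ w N i) →
    ∀ N → N ∈ ln NC → (inp : List Bool) →
      (id N Data.Nat.≤ length inp →
         outputNC NC N inp ≡ just (drop (id N) inp ++ replicate (id N + 1) false)) ×
      (¬ (id N Data.Nat.≤ length inp) →
         outputNC NC N inp ≡ just (replicate (length inp + 1) false))
proposition6p1 NC series initial τ≤w-source τ≤w-pred N N∈ inp =
    (λ id≤ → trans trace (cong just (delayed-≤ id≤)))
  , (λ id≰ → trans trace (cong just (delayed-> (ℕₚ.≰⇒> id≰))))
  where
  trace : outputNC NC N inp ≡ just (delayed (id N) inp)
  trace = Relay.outputNC-delayed NC series initial τ≤w-source τ≤w-pred N∈ inp
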